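{- For all integers $t\ge 4$ and $i\le \frac{t-4}{2}$ one has $d''_i(t)=d'_{i+2}(t+1)-2d'_{i+2}(t)+d'_{i+2}(t-1)$; and for all integers $t\ge 1$ and $i<\frac t2$ one has $d'_i(t)=d''_i(t+1)-2d''_{i-1}(t)+d''_{i-2}(t-1)$.
   Context: Let $V$ be the set of pairs $(i,t)$ of integers with either $(i,t)=(0,0)$ or $0\le i\le t-1$. Define $d'_i(t)$ for $(i,t)\in V$ by: $d'_0(t)=1$ for all $t\ge 0$; $d'_{t-1}(t)=1$ for all $t\ge 3$; for all other $(i,t)\in V$ (i.e. $1\le i\le t-2$, or $(i,t)=(1,2)$), recursively in $t$: if $2i\le t$ then $d'_i(t)=2d'_{i-1}(t-1)+d'_i(t-1)-d'_{i-1}(t-2)$, and if $2i\ge t+1$ then $d'_i(t)=d'_{i-1}(t-1)+2d'_i(t-1)-d'_{i-1}(t-2)$. Set $d'_i(t)=0$ for all integers $i$ and $t\ge0$ with $(i,t)\notin V$, and define $d''_i(t)=d'_{t-1-i}(t)$ for all $i\in\mathbb Z$, $t\ge 0$ (so $d''_i(t)=0$ for $i<0$ except $d''_{ -1}(0)=1$). -}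

module Defs where

open import Data.Nat using (ℕ; zero; suc; _≤ᵇ_; _<ᵇ_)
open import Data.Integer using (ℤ; +_; -[1+_]; _+_; _-_; _*_)
open import Data.Bool using (if_then_else_; _∧_)

dN : ℕ → ℕ → ℤ
dN zero zero = + 1
dN zero (suc t) = + 1
dN (suc i) zero = + 0                    -- not in V
dN (suc i) (suc zero) = + 0              -- not in V (need i+1 ≤ 0)
-- here i' = i+1, t' = t+2; (i',t') ∈ V iff i ≤ t; i' = t'-1 iff i = t
dN (suc i) (suc (suc t)) =
  if t <ᵇ i then + 0
  else (if (i ≤ᵇ t) ∧ (t ≤ᵇ i) ∧ (1 ≤ᵇ t)
        then + 1   -- i = t and t' ≥ 3 : d'_{t'-1}(t') = 1
        else (if (i Data.Nat.+ i) ≤ᵇ t   -- 2i' ≤ t'  iff  2i ≤ t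
              then (+ 2) * dN i (suc t) + dN (suc i) (suc t) - dN i t
              else dN i (suc t) + (+ 2) * dN (suc i) (suc t) - dN i t))

d′ : ℤ → ℕ → ℤ
d′ (+ i) t = dN i t
d′ -[1+ i ] t = + 0

d″ : ℤ → ℕ → ℤ
d″ i t = d′ (+ t - + 1 - i) t

-- Notation: Δ² f s = f (s+2) - 2 f (s+1) + f s is the second difference of a
-- column f centred at time s+1, and "Mirror a e s" is the statement
-- d′_e(s+1) = Δ² d′_a s.  In this language the corollary says that row t,
-- read from the far end, lists the second differences of the columns at t:
--   d′_{t+1-a}(t) = Δ² d′_a at t   when 2a ≤ t   (first half, a = i+2),
--   d′_{t-a}(t)   = Δ² d′_a at t   when 2a > t   (second half, a = t-i).
--
-- Plan.  (1) Every entry off column 0 obeys the low rule (coefficients 2,1)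
-- when 2i ≤ t and the up rule (coefficients 1,2) otherwise, boundary entries
-- included; both are instances of one linear recurrence.  (2) Δ² commutes
-- with such a recurrence, while reflecting a row swaps the low and the up
-- rule; this is the generic induction step mirror-step.  (3) At the middle of
-- a row the rules switch, and the two mirrors there are computed directly
-- (module Middle).  (4) A double induction gives the two families mirrorLow
-- and mirrorHigh.  (5) The corollary is these families rewritten in the
-- integer indexing of d′ and d″.
module Submission where

open import Defs
open import Data.Nat using (ℕ; _≤_; _∸_)
open import Data.Integer using (ℤ; +_; _+_; _-_; _*_) renaming (_≤_ to _≤ℤ_; _<_ to _<ℤ_)
open import Data.Product using (_×_)
open import Relation.Binary.PropositionalEquality using (_≡_)

open import Data.Nat using (zero; suc; _<_; _≤ᵇ_; _<ᵇ_; z≤n; s≤s; z<s; s≤s⁻¹)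
open import Data.Nat.Properties
  using (≤-refl; ≤-reflexive; ≤-trans; <-≤-trans; <-trans; n≤1+n; m≤n⇒m≤1+n; n<1+n; n≮n;
         <⇒≤; <⇒≯; <⇒≱; <-cmp; m≤n⇒m<n∨m≡n; m≤n⇒∃[o]m+o≡n; m≤m+n; m<m+n;
         +-suc; +-comm; +-monoʳ-≤; +-monoˡ-≤; +-mono-≤-<; <ᵇ-reflects-<; ≤ᵇ-reflects-≤)
open import Data.Integer using (-[1+_]; -_)
open import Data.Integer.Properties using (*-identityˡ; drop‿+≤+; drop‿+<+; pos-*)
import Data.Integer.Properties as ℤP
open import Data.Integer.Tactic.RingSolver using (solve-∀; solve)
import Data.Nat.Tactic.RingSolver as ℕ-Solver
import Data.Nat as ℕ
open import Data.Bool using (true; false; if_then_else_)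
open import Data.Product using (_,_)
open import Data.Sum using (inj₁; inj₂)
open import Data.List using (_∷_; [])
open import Function using (_∘_)
open import Relation.Nullary using (¬_)
open import Relation.Nullary.Reflects using (ofʸ; ofⁿ; det)
open import Relation.Binary.Definitions using (tri<; tri≈; tri>)
open import Relation.Binary.PropositionalEquality using (refl; sym; trans; cong; subst; module ≡-Reasoning)
open ≡-Reasoning

<ᵇ-true : ∀ {m n} → m < n → (m <ᵇ n) ≡ true
<ᵇ-true {m} {n} m<n = det (<ᵇ-reflects-< m n) (ofʸ m<n)

<ᵇ-false : ∀ {m n} → ¬ m < n → (m <ᵇ n) ≡ false
<ᵇ-false {m} {n} m≮n = det (<ᵇ-reflects-< m n) (ofⁿ m≮n)

≤ᵇ-true : ∀ {m n} → m ≤ n → (m ≤ᵇ n) ≡ true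
≤ᵇ-true {m} {n} m≤n = det (≤ᵇ-reflects-≤ m n) (ofʸ m≤n)

≤ᵇ-false : ∀ {m n} → ¬ m ≤ n → (m ≤ᵇ n) ≡ false
≤ᵇ-false {m} {n} m≰n = det (≤ᵇ-reflects-≤ m n) (ofⁿ m≰n)

dN-col0 : ∀ t → dN 0 t ≡ + 1
dN-col0 zero    = refl
dN-col0 (suc t) = refl

dN-above : ∀ a t → t ≤ suc a → dN (suc a) t ≡ + 0
dN-above a zero          _         = refl
dN-above a (suc zero)    _         = refl
dN-above a (suc (suc t)) (s≤s t<a) rewrite <ᵇ-true t<a = refl

dN-top : ∀ a → dN (suc a) (suc (suc a)) ≡ + 1
dN-top zero    = refl
dN-top (suc a) rewrite <ᵇ-false (n≮n a) | <ᵇ-true (n<1+n a) = refl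

dN-interior : ∀ a b → a < b → ∀ {low?} → (a ℕ.+ a ≤ᵇ b) ≡ low? →
  dN (suc a) (suc (suc b)) ≡
    (if low? then + 2 * dN a (suc b) + dN (suc a) (suc b) - dN a b
             else dN a (suc b) + + 2 * dN (suc a) (suc b) - dN a b)
dN-interior a b a<b refl
  rewrite <ᵇ-false (<⇒≯ a<b) | ≤ᵇ-true (<⇒≤ a<b) | ≤ᵇ-false (<⇒≱ a<b) = refl

Recurrence : ℤ → ℤ → (ℕ → ℤ) → (ℕ → ℤ) → ℕ → Set
Recurrence p q y x r = x (suc (suc r)) ≡ p * y (suc r) + q * x (suc r) - y r

recurrence-value : ∀ p q {y₁ x₁ y₀ u v w} → y₁ ≡ u → x₁ ≡ v → y₀ ≡ w →
  p * y₁ + q * x₁ - y₀ ≡ p * u + q * v - w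
recurrence-value p q refl refl refl = refl

low-interior : ∀ a b → a < b → a ℕ.+ a ≤ b → Recurrence (+ 2) (+ 1) (dN a) (dN (suc a)) b
low-interior a b a<b h = trans (dN-interior a b a<b (≤ᵇ-true h))
  (cong (λ z → + 2 * dN a (suc b) + z - dN a b) (sym (*-identityˡ (dN (suc a) (suc b)))))

lowRule : ∀ a b → a ℕ.+ a ≤ b → Recurrence (+ 2) (+ 1) (dN a) (dN (suc a)) b
lowRule zero    zero    _ = refl
lowRule zero    (suc b) h = low-interior zero (suc b) z<s h
lowRule (suc a) b       h = low-interior (suc a) b (<-≤-trans (m<m+n (suc a) z<s) h) h

-- The up rule holds wherever 2a > b: inside the triangle by definition, and
-- on the last entry of a row and beyond the diagonal because all terms are
-- 1 or 0 there.
upRule : ∀ a b → b < a ℕ.+ a → Recurrence (+ 1) (+ 2) (dN a) (dN (suc a)) b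
upRule zero    b ()
upRule (suc a) b h with <-cmp b (suc a)
... | tri< b<a _ _ = begin
  dN (suc (suc a)) (suc (suc b))                       ≡⟨ dN-above (suc a) (suc (suc b)) (s≤s b<a) ⟩
  + 1 * + 0 + + 2 * + 0 - + 0                          ≡⟨ recurrence-value (+ 1) (+ 2)
                                                            (dN-above a (suc b) b<a)
                                                            (dN-above (suc a) (suc b) (m≤n⇒m≤1+n b<a))
                                                            (dN-above a b (m≤n⇒m≤1+n (s≤s⁻¹ b<a))) ⟨
  + 1 * dN (suc a) (suc b) + + 2 * dN (suc (suc a)) (suc b) - dN (suc a) b ∎
... | tri≈ _ refl _ = begin
  dN (suc (suc a)) (suc (suc (suc a)))                 ≡⟨ dN-top (suc a) ⟩
  + 1 * + 1 + + 2 * + 0 - + 0                          ≡⟨ recurrence-value (+ 1) (+ 2)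
                                                            (dN-top a)
                                                            (dN-above (suc a) (suc (suc a)) ≤-refl)
                                                            (dN-above a (suc a) ≤-refl) ⟨
  + 1 * dN (suc a) (suc (suc a)) + + 2 * dN (suc (suc a)) (suc (suc a)) - dN (suc a) (suc a) ∎
... | tri> _ _ a<b = trans (dN-interior (suc a) b a<b (≤ᵇ-false (<⇒≱ h)))
  (cong (λ z → z + + 2 * dN (suc (suc a)) (suc b) - dN (suc a) b) (sym (*-identityˡ (dN (suc a) (suc b)))))

dN-col1 : ∀ s → dN 1 (suc s) ≡ + s
dN-col1 zero    = refl
dN-col1 (suc s) = begin
  dN 1 (suc (suc s))                          ≡⟨ lowRule 0 s z≤n ⟩
  + 2 * dN 0 (suc s) + + 1 * dN 1 (suc s) - dN 0 s
                                              ≡⟨ recurrence-value (+ 2) (+ 1) (dN-col0 (suc s)) (dN-col1 s) (dN-col0 s) ⟩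
  + 2 * + 1 + + 1 * + s - + 1                 ≡⟨ arithmetic (+ s) ⟩
  + suc s                                     ∎
  where
  arithmetic : ∀ x → + 2 * + 1 + + 1 * x - + 1 ≡ + 1 + x
  arithmetic = solve-∀

Δ² : (ℕ → ℤ) → ℕ → ℤ
Δ² f s = f (suc (suc s)) - + 2 * f (suc s) + f s

Δ²-eval : ∀ f s {u v w} → f (suc (suc s)) ≡ u → f (suc s) ≡ v → f s ≡ w →
  Δ² f s ≡ u - + 2 * v + w
Δ²-eval f s refl refl refl = refl

Δ²-column1 : ∀ s → Δ² (dN 1) (suc s) ≡ + 0
Δ²-column1 s = trans (Δ²-eval (dN 1) (suc s) (dN-col1 (suc (suc s))) (dN-col1 (suc s)) (dN-col1 s))
                     (flat (+ s))
  where
  flat : ∀ x → (+ 2 + x) - + 2 * (+ 1 + x) + x ≡ + 0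
  flat = solve-∀

Δ²-recurrence : ∀ p q (y x : ℕ → ℤ) s →
  Recurrence p q y x s → Recurrence p q y x (suc s) → Recurrence p q y x (suc (suc s)) →
  Recurrence p q (Δ² y) (Δ² x) s
Δ²-recurrence p q y x s =
  expand {y s} {y (suc s)} {y (suc (suc s))} {y (suc (suc (suc s)))}
         {x (suc s)} {x (suc (suc s))} {x (suc (suc (suc s)))} {x (suc (suc (suc (suc s))))}
  where
  expand : ∀ {y₀ y₁ y₂ y₃ x₁ x₂ x₃ x₄} →
    x₂ ≡ p * y₁ + q * x₁ - y₀ → x₃ ≡ p * y₂ + q * x₂ - y₁ → x₄ ≡ p * y₃ + q * x₃ - y₂ →
    x₄ - + 2 * x₃ + x₂ ≡
      p * (y₃ - + 2 * y₂ + y₁) + q * (x₃ - + 2 * x₂ + x₁) - (y₂ - + 2 * y₁ + y₀)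
  expand {y₀} {y₁} {y₂} {y₃} {x₁} refl refl refl = solve (p ∷ q ∷ y₀ ∷ y₁ ∷ y₂ ∷ y₃ ∷ x₁ ∷ [])

Mirror : ℕ → ℕ → ℕ → Set
Mirror a e s = dN e (suc s) ≡ Δ² (dN a) s

mirror-step : ∀ p q a e s →
  Recurrence p q (dN a) (dN (suc a)) s →
  Recurrence p q (dN a) (dN (suc a)) (suc s) →
  Recurrence p q (dN a) (dN (suc a)) (suc (suc s)) →
  Recurrence q p (dN e) (dN (suc e)) (suc s) →
  Mirror (suc a) e (suc s) → Mirror a (suc e) (suc s) → Mirror a e s →
  Mirror (suc a) (suc e) (suc (suc s))
mirror-step p q a e s column₀ column₁ column₂ entry mirror₁ mirror₂ mirror₀ = begin
  dN (suc e) (suc (suc (suc s)))                                    ≡⟨ entry ⟩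
  q * dN e (suc (suc s)) + p * dN (suc e) (suc (suc s)) - dN e (suc s)
                                                                    ≡⟨ recurrence-value q p mirror₁ mirror₂ mirror₀ ⟩
  q * Δ² X (suc s) + p * Δ² Y (suc s) - Δ² Y s                      ≡⟨ cong (_- Δ² Y s) (ℤP.+-comm (q * Δ² X (suc s)) (p * Δ² Y (suc s))) ⟩
  p * Δ² Y (suc s) + q * Δ² X (suc s) - Δ² Y s                      ≡⟨ Δ²-recurrence p q Y X s column₀ column₁ column₂ ⟨
  Δ² X (suc (suc s))                                                ∎
  where
  Y X : ℕ → ℤ
  Y = dN a
  X = dN (suc a)

double : ∀ m → suc m ℕ.+ suc m ≡ suc (suc (m ℕ.+ m))
double m = cong suc (+-suc m m)

-- Around rows 2m+3 .. 2m+6 the columns W, Y, X (indices m+1, m+2, m+3) pass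
-- the middle of the row, where their recurrences switch from the up rule to
-- the low rule.  The two mirrors at which the generic step does not apply are
-- computed there directly.
module Middle (m : ℕ) where

  W Y X : ℕ → ℤ
  W = dN (suc m)
  Y = dN (suc (suc m))
  X = dN (suc (suc (suc m)))

  r : ℕ
  r = suc (m ℕ.+ m)

  double₂ : suc (suc m) ℕ.+ suc (suc m) ≡ suc (suc (suc (suc (m ℕ.+ m))))
  double₂ = trans (double (suc m)) (cong (suc ∘ suc) (double m))

  Y-up : Recurrence (+ 1) (+ 2) W Y r
  Y-up = upRule (suc m) r (≤-reflexive (sym (double m)))

  Y-low₁ : Recurrence (+ 2) (+ 1) W Y (suc r)
  Y-low₁ = lowRule (suc m) (suc r) (≤-reflexive (double m))

  Y-low₂ : Recurrence (+ 2) (+ 1) W Y (suc (suc r))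
  Y-low₂ = lowRule (suc m) (suc (suc r)) (m≤n⇒m≤1+n (≤-reflexive (double m)))

  X-up₁ : Recurrence (+ 1) (+ 2) Y X (suc r)
  X-up₁ = upRule (suc (suc m)) (suc r) (≤-trans (n≤1+n _) (≤-reflexive (sym double₂)))

  X-up₂ : Recurrence (+ 1) (+ 2) Y X (suc (suc r))
  X-up₂ = upRule (suc (suc m)) (suc (suc r)) (≤-reflexive (sym double₂))

  X-low₃ : Recurrence (+ 2) (+ 1) Y X (suc (suc (suc r)))
  X-low₃ = lowRule (suc (suc m)) (suc (suc (suc r))) (≤-reflexive double₂)

  -- d′_{m+3}(2m+4) = Δ² d′_{m+2} at 2m+4 (the case j = m+1 of mirrorLow),
  -- from two mirrors of column m+1.
  middle-low : Mirror (suc m) (suc (suc (suc m))) (suc r) → Mirror (suc m) (suc (suc m)) r →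
    Mirror (suc (suc m)) (suc (suc (suc m))) (suc (suc r))
  middle-low = algebra {W r} {W (suc r)} {W (suc (suc r))} {W (suc (suc (suc r)))}
                       {Y (suc r)} {Y (suc (suc r))} {Y (suc (suc (suc r)))} {Y (suc (suc (suc (suc r))))}
                       {X (suc (suc r))} {X (suc (suc (suc r)))}
                       Y-up Y-low₁ Y-low₂ X-up₁
    where
    algebra : ∀ {w₀ w₁ w₂ w₃ y₁ y₂ y₃ y₄ x₂ x₃} →
      y₂ ≡ + 1 * w₁ + + 2 * y₁ - w₀ → y₃ ≡ + 2 * w₂ + + 1 * y₂ - w₁ →
      y₄ ≡ + 2 * w₃ + + 1 * y₃ - w₂ → x₃ ≡ + 1 * y₂ + + 2 * x₂ - y₁ →
      x₂ ≡ w₃ - + 2 * w₂ + w₁ → y₁ ≡ w₂ - + 2 * w₁ + w₀ →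
      x₃ ≡ y₄ - + 2 * y₃ + y₂
    algebra {w₀} {w₁} {w₂} {w₃} refl refl refl refl refl refl = solve (w₀ ∷ w₁ ∷ w₂ ∷ w₃ ∷ [])

  -- d′_{m+2}(2m+5) = Δ² d′_{m+3} at 2m+5 (the case n = c = m+2 of
  -- mirrorHigh) follows from the previous mirror.
  middle-high : Mirror (suc (suc m)) (suc (suc (suc m))) (suc (suc r)) →
    Mirror (suc (suc (suc m))) (suc (suc m)) (suc (suc (suc r)))
  middle-high = algebra {Y (suc (suc r))} {Y (suc (suc (suc r)))} {Y (suc (suc (suc (suc r))))}
                        {X (suc (suc (suc r)))} {X (suc (suc (suc (suc r))))} {X (suc (suc (suc (suc (suc r)))))}
                        X-low₃ X-up₂
    where
    algebra : ∀ {y₂ y₃ y₄ x₃ x₄ x₅} →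
      x₅ ≡ + 2 * y₄ + + 1 * x₄ - y₃ → x₄ ≡ + 1 * y₃ + + 2 * x₃ - y₂ →
      x₃ ≡ y₄ - + 2 * y₃ + y₂ → y₄ ≡ x₅ - + 2 * x₄ + x₃
    algebra {y₂} {y₃} {y₄} refl refl refl = solve (y₂ ∷ y₃ ∷ y₄ ∷ [])

mirrorLow : ∀ m j {s} → m ≤ j → m ℕ.+ j ≡ s → Mirror (suc m) (suc (suc j)) (suc s)
mirrorLow zero j _ refl = begin
  dN (suc (suc j)) (suc (suc j))   ≡⟨ dN-above (suc j) (suc (suc j)) ≤-refl ⟩
  + 0                              ≡⟨ Δ²-column1 j ⟨
  Δ² (dN 1) (suc j)                ∎
mirrorLow (suc m) (suc j) (s≤s m≤j) refl with m≤n⇒m<n∨m≡n m≤j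
... | inj₁ m<j = subst (Mirror (suc (suc m)) (suc (suc (suc j)))) (cong (suc ∘ suc) (sym (+-suc m j)))
  (mirror-step (+ 2) (+ 1) (suc m) (suc (suc j)) (suc (m ℕ.+ j))
    (lowRule (suc m) _ column) (lowRule (suc m) _ (m≤n⇒m≤1+n column))
    (lowRule (suc m) _ (m≤n⇒m≤1+n (m≤n⇒m≤1+n column)))
    (upRule (suc (suc j)) _ (+-mono-≤-< (s≤s (s≤s m≤j)) (n≤1+n (suc j))))
    (mirrorLow (suc m) j m<j refl)
    (mirrorLow m (suc j) (m≤n⇒m≤1+n m≤j) (+-suc m j))
    (mirrorLow m j m≤j refl))
  where
  column : suc m ℕ.+ suc m ≤ suc (m ℕ.+ j)
  column = s≤s (+-monoʳ-≤ m m<j)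
... | inj₂ refl = subst (Mirror (suc (suc m)) (suc (suc (suc m)))) (cong (suc ∘ suc) (sym (+-suc m m)))
  (Middle.middle-low m (mirrorLow m (suc m) (n≤1+n m) (+-suc m m)) (mirrorLow m m ≤-refl refl))

mirror-middle : ∀ n → Mirror (suc (suc n)) (suc n) (suc n ℕ.+ suc n)
mirror-middle zero    = refl
mirror-middle (suc p) = subst (Mirror (suc (suc (suc p))) (suc (suc p))) (sym (Middle.double₂ p))
  (Middle.middle-high p (mirrorLow (suc p) (suc p) ≤-refl (double p)))

mirrorHigh : ∀ n c {s} → n ≤ c → n ℕ.+ c ≡ s → Mirror (suc c) n s
mirrorHigh zero c _ refl =
  sym (Δ²-eval (dN (suc c)) c (dN-top c) (dN-above c (suc c) ≤-refl) (dN-above c c (n≤1+n c)))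
mirrorHigh (suc n) (suc c) (s≤s n≤c) refl with m≤n⇒m<n∨m≡n n≤c
... | inj₁ n<c = subst (Mirror (suc (suc c)) (suc n)) (cong suc (sym (+-suc n c)))
  (mirror-step (+ 1) (+ 2) (suc c) n (n ℕ.+ c)
    (upRule (suc c) _ (<-trans (n<1+n _) column₁)) (upRule (suc c) _ column₁) (upRule (suc c) _ column₂)
    (lowRule n _ (m≤n⇒m≤1+n (+-monoʳ-≤ n n≤c)))
    (mirrorHigh n (suc c) (m≤n⇒m≤1+n n≤c) (+-suc n c))
    (mirrorHigh (suc n) c n<c refl)
    (mirrorHigh n c n≤c refl))
  where
  column₂ : suc (suc (n ℕ.+ c)) < suc c ℕ.+ suc c
  column₂ = subst (_≤ suc c ℕ.+ suc c) (cong (suc ∘ suc) (+-suc n c)) (+-monoˡ-≤ (suc c) (s≤s n<c))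
  column₁ : suc (n ℕ.+ c) < suc c ℕ.+ suc c
  column₁ = <-trans (n<1+n _) column₂
... | inj₂ refl = mirror-middle n

Δ²-centred : ∀ (f : ℕ → ℤ) s → Δ² f s ≡ f (suc s ℕ.+ 1) - + 2 * f (suc s) + f s
Δ²-centred f s = cong (λ k → f k - + 2 * f (suc s) + f s) (cong suc (+-comm 1 s))

Δ²-via-d″ : ∀ i s → Δ² (d′ (+ suc s - i)) s ≡
  d″ i (suc s ℕ.+ 1) - + 2 * d″ (i - + 1) (suc s) + d″ (i - + 2) s
Δ²-via-d″ i s = trans (Δ²-centred (d′ (+ suc s - i)) s)
  (reindex (index₁ (+ suc s) i) (index₀ (+ suc s) i) (index₋₁ (+ s) i))
  where
  reindex : ∀ {j₁ j₀ j₋₁} → + suc s - i ≡ j₁ → + suc s - i ≡ j₀ → + suc s - i ≡ j₋₁ →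
    d′ (+ suc s - i) (suc s ℕ.+ 1) - + 2 * d′ (+ suc s - i) (suc s) + d′ (+ suc s - i) s ≡
    d′ j₁ (suc s ℕ.+ 1) - + 2 * d′ j₀ (suc s) + d′ j₋₁ s
  reindex refl refl refl = refl
  index₁ : ∀ x y → x - y ≡ x + + 1 - + 1 - y
  index₁ = solve-∀
  index₀ : ∀ x y → x - y ≡ x - + 1 - (y - + 1)
  index₀ = solve-∀
  index₋₁ : ∀ x y → + 1 + x - y ≡ x - + 1 - (y - + 2)
  index₋₁ = solve-∀

d″-negative : ∀ q t → d″ -[1+ q ] (suc t) ≡ + 0
d″-negative q t = trans (cong (λ j → d′ j (suc t)) (index (+ t) (+ q)))
                        (dN-above (t ℕ.+ q) (suc t) (s≤s (m≤m+n t q)))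
  where
  index : ∀ x y → + 1 + x - + 1 - (- (+ 1 + y)) ≡ + 1 + (x + y)
  index = solve-∀

Δ²-flat-columns : ∀ q s → Δ² (d′ (-[1+ q ] + + 2)) (suc s) ≡ + 0
Δ²-flat-columns zero          s = Δ²-column1 s
Δ²-flat-columns (suc zero)    s = refl
Δ²-flat-columns (suc (suc q)) s = refl

partA : ∀ u i → + 2 * i ≤ℤ + u → d″ i (4 ℕ.+ u) ≡ Δ² (d′ (i + + 2)) (3 ℕ.+ u)
partA u (+ n) 2n≤u with m≤n⇒∃[o]m+o≡n (drop‿+≤+ (subst (_≤ℤ + u) (sym (pos-* 2 n)) 2n≤u))
... | r , refl = begin
  d″ (+ n) (4 ℕ.+ (2 ℕ.* n ℕ.+ r))              ≡⟨ cong (λ j → d′ j (4 ℕ.+ (2 ℕ.* n ℕ.+ r))) (index (+ n) (+ r)) ⟩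
  dN (3 ℕ.+ (n ℕ.+ r)) (4 ℕ.+ (2 ℕ.* n ℕ.+ r))  ≡⟨ mirrorLow (suc n) (suc (n ℕ.+ r)) (s≤s (m≤m+n n r)) (time n r) ⟩
  Δ² (dN (2 ℕ.+ n)) (3 ℕ.+ (2 ℕ.* n ℕ.+ r))     ≡⟨ cong (λ k → Δ² (dN k) (3 ℕ.+ (2 ℕ.* n ℕ.+ r))) (+-comm 2 n) ⟩
  Δ² (d′ (+ n + + 2)) (3 ℕ.+ (2 ℕ.* n ℕ.+ r))   ∎
  where
  index : ∀ x y → + 4 + (x + (x + + 0) + y) - + 1 - x ≡ + 3 + (x + y)
  index = solve-∀
  time : ∀ n r → suc n ℕ.+ suc (n ℕ.+ r) ≡ 2 ℕ.+ (2 ℕ.* n ℕ.+ r)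
  time = ℕ-Solver.solve-∀
partA u -[1+ q ] _ = trans (d″-negative q (3 ℕ.+ u)) (sym (Δ²-flat-columns q (2 ℕ.+ u)))

partB : ∀ s i → + 2 * i <ℤ + suc s → d′ i (suc s) ≡ Δ² (d′ (+ suc s - i)) s
partB s (+ n) 2n<t with m≤n⇒∃[o]m+o≡n (s≤s⁻¹ (drop‿+<+ (subst (_<ℤ + suc s) (sym (pos-* 2 n)) 2n<t)))
... | r , refl = begin
  dN n (suc (2 ℕ.* n ℕ.+ r))                               ≡⟨ mirrorHigh n (n ℕ.+ r) (m≤m+n n r) (time n r) ⟩
  Δ² (dN (suc (n ℕ.+ r))) (2 ℕ.* n ℕ.+ r)                  ≡⟨ cong (λ j → Δ² (d′ j) (2 ℕ.* n ℕ.+ r)) (index (+ n) (+ r)) ⟨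
  Δ² (d′ (+ suc (2 ℕ.* n ℕ.+ r) - + n)) (2 ℕ.* n ℕ.+ r)    ∎
  where
  index : ∀ x y → + 1 + (x + (x + + 0) + y) - x ≡ + 1 + (x + y)
  index = solve-∀
  time : ∀ n r → n ℕ.+ (n ℕ.+ r) ≡ 2 ℕ.* n ℕ.+ r
  time = ℕ-Solver.solve-∀
partB s -[1+ q ] _ = sym (Δ²-eval (dN (suc s ℕ.+ suc q)) s
  (dN-above (s ℕ.+ suc q) (suc (suc s)) beyond)
  (dN-above (s ℕ.+ suc q) (suc s) (≤-trans (n≤1+n _) beyond))
  (dN-above (s ℕ.+ suc q) s (≤-trans (n≤1+n _) (≤-trans (n≤1+n _) beyond))))
  where
  beyond : suc (suc s) ≤ suc (s ℕ.+ suc q)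
  beyond = s≤s (m<m+n s z<s)

corollary3 : ((t : ℕ) (i : ℤ) → 4 ≤ t → (+ 2) * i ≤ℤ + t - + 4 →
    d″ i t ≡ d′ (i + + 2) (Data.Nat._+_ t 1) - (+ 2) * d′ (i + + 2) t + d′ (i + + 2) (t ∸ 1))
    ×
    ((t : ℕ) (i : ℤ) → 1 ≤ t → (+ 2) * i <ℤ + t →
    d′ i t ≡ d″ i (Data.Nat._+_ t 1) - (+ 2) * d″ (i - + 1) t + d″ (i - + 2) (t ∸ 1))
corollary3 = below , above
  where
  below : (t : ℕ) (i : ℤ) → 4 ≤ t → (+ 2) * i ≤ℤ + t - + 4 →
    d″ i t ≡ d′ (i + + 2) (Data.Nat._+_ t 1) - (+ 2) * d′ (i + + 2) t + d′ (i + + 2) (t ∸ 1)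
  below _ i (s≤s (s≤s (s≤s (s≤s {n = u} _)))) 2i≤t-4 =
    trans (partA u i 2i≤t-4) (Δ²-centred (d′ (i + + 2)) (3 ℕ.+ u))
  above : (t : ℕ) (i : ℤ) → 1 ≤ t → (+ 2) * i <ℤ + t →
    d′ i t ≡ d″ i (Data.Nat._+_ t 1) - (+ 2) * d″ (i - + 1) t + d″ (i - + 2) (t ∸ 1)
  above _ i (s≤s {n = s} _) 2i<t = trans (partB s i 2i<t) (Δ²-via-d″ i s)
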